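{- Let $\alpha,\beta,\gamma\in\mathcal{NCP}(n)$ be such that the triple $(\alpha,\beta,\gamma)$ is admissible. Then $$K_{\alpha\circ\beta\circ\gamma}(\alpha\circ\beta)=\gamma=K_{K_{\alpha\circ\beta\circ\gamma}(\alpha)}\big(K_{\alpha\circ\beta}(\alpha)\big).$$
   Context: A partition of $[m]=\{1,\dots,m\}$ is noncrossing if there are no two distinct blocks $B,C$ and $a<b<c<d$ with $a,c\in B$, $b,d\in C$. $\mathcal{NCP}(m)$ is the lattice of noncrossing partitions of $[m]$ under refinement ($\pi\mid\mu$ iff each block of $\pi$ lies in a block of $\mu$), with join $\vee$. For $\alpha_1,\dots,\alpha_k\in\mathcal{NCP}(n)$, $\alpha_1\ast_n\cdots\ast_n\alpha_k$ is the partition of $[kn]$ with blocks $\{k(x-1)+i:x\in B\}$ for $1\le i\le k$ and $B$ a block of $\alpha_i$; the $k$-tuple is admissible if this partition is noncrossing. For an admissible pair, $\alpha\circ\beta:=\sqrt{(\alpha\ast_n\beta)\vee\{\{1,2\},\dots,\{2n-1,2n\}\}}$ (join in $\mathcal{NCP}(2n)$), where for $\gamma\in\mathcal{NCP}(2n)$ with $2i-1,2i$ always in the same block, $\sqrt\gamma$ has blocks $\{i:2i\in D\}$, $D$ a block of $\gamma$; $\circ$ is undefined on non-admissible pairs, and it is a partial monoid operation (so $\alpha\circ\beta\circ\gamma$ is unambiguous when defined). For $\alpha\mid\beta$ in $\mathcal{NCP}(n)$, the relative Kreweras complement $K_\beta(\alpha)$ is the unique $\delta\in\mathcal{NCP}(n)$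 with $(\alpha,\delta)$ admissible and $\alpha\circ\delta=\beta$. -}

module Defs where

open import Data.Nat using (ℕ; zero; suc; _*_)
open import Data.Fin using (Fin; zero; suc; _<_; combine; remQuot)
open import Data.Bool using (Bool; true; false; _∧_)
open import Data.Product using (Σ; Σ-syntax; _×_; _,_; proj₁; proj₂)
open import Relation.Binary.PropositionalEquality using (_≡_; refl; subst)
open import Function.Bundles using (_⇔_)

eqF : ∀ {k} → Fin k → Fin k → Bool
eqF zero    zero    = true
eqF zero    (suc _) = false
eqF (suc _) zero    = false
eqF (suc i) (suc j) = eqF i j

eqF-refl : ∀ {k} (i : Fin k) → eqF i i ≡ true
eqF-refl zero    = refl
eqF-refl (suc i) = eqF-refl i

eqF-sound : ∀ {k} (i j : Fin k) → eqF i j ≡ true → i ≡ j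
eqF-sound zero    zero    _ = refl
eqF-sound zero    (suc _) ()
eqF-sound (suc _) zero    ()
eqF-sound (suc i) (suc j) e with eqF-sound i j e
... | refl = refl

∧-l : ∀ {a b} → a ∧ b ≡ true → a ≡ true
∧-l {true} _ = refl

∧-r : ∀ {a b} → a ∧ b ≡ true → b ≡ true
∧-r {true} e = e

∧-intro : ∀ {a b} → a ≡ true → b ≡ true → a ∧ b ≡ true
∧-intro refl refl = refl

-- Set partitions of [m] = Fin m (0-based), given by their
-- (decidable, Boolean) "same block" equivalence relation.

record Partition (m : ℕ) : Set where
  field
    rel   : Fin m → Fin m → Bool
    rrefl : ∀ i → rel i i ≡ true
    rsym  : ∀ i j → rel i j ≡ true → rel j i ≡ true
    rtrans : ∀ i j k → rel i j ≡ true → rel j k ≡ true → rel i k ≡ true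
open Partition public

Same : ∀ {m} → Partition m → Fin m → Fin m → Set
Same π i j = rel π i j ≡ true

_≈_ : ∀ {m} → Partition m → Partition m → Set
π ≈ σ = ∀ i j → rel π i j ≡ rel σ i j

_≼_ : ∀ {m} → Partition m → Partition m → Set
π ≼ σ = ∀ i j → Same π i j → Same σ i j

NonCrossing : ∀ {m} → Partition m → Set
NonCrossing π = ∀ a b c d → a < b → b < c → c < d →
  Same π a c → Same π b d → Same π a b

kernel : ∀ {m r} → (Fin m → Fin r) → Partition m
kernel f = record
  { rel = λ i j → eqF (f i) (f j)
  ; rrefl = λ i → eqF-refl (f i)
  ; rsym = λ i j e → subst (λ z → eqF z (f i) ≡ true) (eqF-sound (f i) (f j) e) (eqF-refl (f i))
  ; rtrans = λ i j k e₁ e₂ → subst (λ z → eqF (f i) z ≡ true) (eqF-sound (f j) (f k) e₂) e₁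
  }

-- The interleaved product α₁ ∗ₙ ⋯ ∗ₙ αₖ, a partition of [kn].
-- Position k(x-1)+i (1-based, x ∈ [n], i ∈ [k]) is the 0-based index
-- combine x i = x*k + i of Fin (n * k), decoded by remQuot k.

starRel : ∀ {n k} → (Fin k → Partition n) → Fin n × Fin k → Fin n × Fin k → Bool
starRel α (x , i) (y , j) = eqF i j ∧ rel (α i) x y

starRel-refl : ∀ {n k} (α : Fin k → Partition n) p → starRel α p p ≡ true
starRel-refl α (x , i) = ∧-intro (eqF-refl i) (rrefl (α i) x)

starRel-sym : ∀ {n k} (α : Fin k → Partition n) p q → starRel α p q ≡ true → starRel α q p ≡ true
starRel-sym α (x , i) (y , j) e with eqF-sound i j (∧-l e)
... | refl = ∧-intro (eqF-refl i) (rsym (α i) x y (∧-r e))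

starRel-trans : ∀ {n k} (α : Fin k → Partition n) p q r →
  starRel α p q ≡ true → starRel α q r ≡ true → starRel α p r ≡ true
starRel-trans α (x , i) (y , j) (z , l) e₁ e₂ with eqF-sound i j (∧-l e₁) | eqF-sound j l (∧-l e₂)
... | refl | refl = ∧-intro (eqF-refl i) (rtrans (α i) x y z (∧-r e₁) (∧-r e₂))

star : ∀ {n} k → (Fin k → Partition n) → Partition (n * k)
star {n} k α = record
  { rel = λ p q → starRel α (remQuot k p) (remQuot k q)
  ; rrefl = λ p → starRel-refl α (remQuot k p)
  ; rsym = λ p q → starRel-sym α (remQuot k p) (remQuot k q)
  ; rtrans = λ p q r → starRel-trans α (remQuot k p) (remQuot k q) (remQuot k r)
  }

pair : ∀ {n} → Partition n → Partition n → Fin 2 → Partition n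
pair α β zero       = α
pair α β (suc zero) = β

triple : ∀ {n} → Partition n → Partition n → Partition n → Fin 3 → Partition n
triple α β γ zero             = α
triple α β γ (suc zero)       = β
triple α β γ (suc (suc zero)) = γ

Admissible₂ : ∀ {n} → Partition n → Partition n → Set
Admissible₂ α β = NonCrossing (star 2 (pair α β))

Admissible₃ : ∀ {n} → Partition n → Partition n → Partition n → Set
Admissible₃ α β γ = NonCrossing (star 3 (triple α β γ))

IsJoinNC : ∀ {m} → Partition m → Partition m → Partition m → Set
IsJoinNC π σ ρ = NonCrossing ρ × π ≼ ρ × σ ≼ ρ ×
  (∀ τ → NonCrossing τ → π ≼ τ → σ ≼ τ → ρ ≼ τ)

-- the partition {{1,2},{3,4},…,{2n-1,2n}} of [2n]
pairing : ∀ n → Partition (n * 2)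
pairing n = kernel (λ p → proj₁ (remQuot {n} 2 p))

-- √γ : blocks {i : 2i ∈ D}; 1-based 2i is the 0-based index combine x 1
sqrtP : ∀ {n} → Partition (n * 2) → Partition n
sqrtP {n} γ = record
  { rel = λ x y → rel γ (c x) (c y)
  ; rrefl = λ x → rrefl γ (c x)
  ; rsym = λ x y → rsym γ (c x) (c y)
  ; rtrans = λ x y z → rtrans γ (c x) (c y) (c z)
  }
  where
  c : Fin n → Fin (n * 2)
  c x = combine x (suc zero)

-- Comp α β ρ : "(α,β) is admissible and α ∘ β = ρ"
Comp : ∀ {n} → Partition n → Partition n → Partition n → Set
Comp {n} α β ρ = Admissible₂ α β ×
  Σ[ j ∈ Partition (n * 2) ] (IsJoinNC (star 2 (pair α β)) (pairing n) j × sqrtP j ≈ ρ)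

-- IsKrew β α δ : "δ ∈ NCP(n), (α,δ) admissible and α ∘ δ = β",
-- i.e. δ satisfies the defining property of K_β(α).
IsKrew : ∀ {n} → Partition n → Partition n → Partition n → Set
IsKrew β α δ = NonCrossing δ × Comp α δ β

{-# OPTIONS --safe #-}
module Submission where

-- For an admissible pair (α, β) the composite α ∘ β is the join α ⊔ β of α and β as
-- equivalence relations: √((α ∗ β) ∨ pairing) is obtained by merging the two copies of
-- each point one at a time, and merging two neighbouring points keeps a partition
-- noncrossing. Admissibility of (π, δ) says that whenever x and y share a δ-block, the
-- interval between them is a union of π-blocks. Conversely, two points x and y of one
-- (π ⊔ δ)-block with this property share a δ-block: on a path of π- and δ-steps from x to
-- y, the first step from the side of x to the side of y is a δ-step u → v, the intervals
-- between x and u and between v and y are again unions of π-blocks, and induction on the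
-- length of the path applies. Hence δ is determined by π and π ∘ δ. An admissible triple
-- makes (α, β), (β, γ), (α ⊔ β, γ) and (α, β ⊔ γ) admissible, so α ∘ β ∘ γ = α ⊔ β ⊔ γ,
-- K_{α∘β∘γ}(α) = β ⊔ γ = β ∘ γ and K_{α∘β}(α) = β, and both equalities follow from
-- uniqueness.

open import Defs
open import Data.Bool using (Bool; true; false; T; _∧_; _∨_; not; _xor_)
import Data.Bool as Bool
open import Data.Bool.Properties
  using (∧-conicalˡ; ∧-conicalʳ; ¬-not; not-involutive; xor-same; xor-comm)
open import Data.Empty using (⊥-elim)
open import Data.Fin using (Fin; zero; suc; toℕ; combine; remQuot; quotient; _<_; _≤_; _≟_)
open import Data.Fin.Properties
  using (toℕ-injective; toℕ-combine; combine-monoˡ-<; remQuot-combine; combine-remQuot;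
         <-cmp; <-asym; ≤-refl; <⇒≢)
open import Data.List using (List; []; _∷_; allFin)
open import Data.List.Membership.Propositional using (_∈_)
open import Data.List.Membership.Propositional.Properties using (∈-allFin)
open import Data.List.Relation.Unary.Any using (here; there)
open import Data.Nat using (ℕ)
import Data.Nat as ℕ
open import Data.Nat.Induction using (<-wellFounded)
import Data.Nat.Properties as ℕₚ
open import Data.Product using (Σ-syntax; _×_; _,_; proj₁; proj₂; uncurry)
open import Data.Sum using (_⊎_; inj₁; inj₂)
open import Function using (id; _∘_; _on_)
open import Function.Bundles using (_⇔_; mk⇔; Equivalence)
open import Induction.WellFounded using (Acc; acc)
open import Level using (0ℓ)
open import Relation.Binary.Bundles using (Setoid)
open import Relation.Binary.Core using (Rel; _⇒_)
open import Relation.Binary.Construct.Closure.ReflexiveTransitive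
  using (Star; ε; _◅_; _◅◅_; reverse; return)
import Relation.Binary.Construct.On as On
open import Relation.Binary.Construct.Union as Union using (_∪_)
open import Relation.Binary.Definitions using (tri<; tri≈; tri>)
import Relation.Binary.PropositionalEquality as ≡
open import Relation.Binary.PropositionalEquality
  using (_≡_; _≢_; refl; sym; trans; cong; cong₂; subst; subst₂; module ≡-Reasoning)
import Relation.Binary.Reasoning.Setoid as SetoidReasoning
open import Relation.Binary.Structures using (IsEquivalence)
open import Relation.Nullary using (¬_; yes; no; contradiction)
open import Relation.Nullary.Reflects using (Reflects; ofʸ; ofⁿ)

private
  variable
    m n : ℕ

∨-true : ∀ {a b} → a ∨ b ≡ true → a ≡ true ⊎ b ≡ true
∨-true {true}  _ = inj₁ refl
∨-true {false} b = inj₂ b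

∨-trueˡ : ∀ {a b} → a ≡ true → a ∨ b ≡ true
∨-trueˡ refl = refl

∨-trueʳ : ∀ {a b} → b ≡ true → a ∨ b ≡ true
∨-trueʳ {true}  _ = refl
∨-trueʳ {false} b = b

∧-true : ∀ {a b} → a ≡ true → b ≡ true → a ∧ b ≡ true
∧-true refl b = b

true≢false : true ≢ false
true≢false ()

true-ext : ∀ {a b} → (a ≡ true → b ≡ true) → (b ≡ true → a ≡ true) → a ≡ b
true-ext {true}  a⇒b _ = sym (a⇒b refl)
true-ext {false} {true}  _ b⇒a = b⇒a refl
true-ext {false} {false} _ _ = refl

Same-isEquivalence : (π : Partition m) → IsEquivalence (Same π)
Same-isEquivalence π = record { refl = rrefl π _ ; sym = rsym π _ _ ; trans = rtrans π _ _ _ }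

module Same {m} (π : Partition m) = IsEquivalence (Same-isEquivalence π)

≈-isEquivalence : IsEquivalence (_≈_ {m})
≈-isEquivalence = record
  { refl = λ _ _ → refl
  ; sym = λ π≈σ i j → sym (π≈σ i j)
  ; trans = λ π≈σ σ≈τ i j → trans (π≈σ i j) (σ≈τ i j)
  }

module ≈ {m} = IsEquivalence (≈-isEquivalence {m})

≈⇒≼ : {π σ : Partition m} → π ≈ σ → π ≼ σ
≈⇒≼ π≈σ i j = subst (_≡ true) (π≈σ i j)

≼-antisym : {π σ : Partition m} → π ≼ σ → σ ≼ π → π ≈ σ
≼-antisym π≼σ σ≼π i j = true-ext (π≼σ i j) (σ≼π i j)

NonCrossing-resp-≈ : {π σ : Partition m} → π ≈ σ → NonCrossing π → NonCrossing σ
NonCrossing-resp-≈ {π = π} {σ} π≈σ nc a b c d a<b b<c c<d ac bd =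
  ≈⇒≼ {π = π} {σ} π≈σ a b (nc a b c d a<b b<c c<d (σ≼π a c ac) (σ≼π b d bd))
  where
  σ≼π : σ ≼ π
  σ≼π = ≈⇒≼ {π = σ} {π} (≈.sym {x = π} {σ} π≈σ)

NonCrossing-nested : {E : Partition m} {b d t t′ : Fin m} → NonCrossing E →
  Same E b d → Same E t t′ → ¬ Same E b t → b < t × t < d → b < t′ × t′ < d
NonCrossing-nested {E = E} {b} {d} {t} {t′} nc bd tt′ ¬bt (b<t , t<d) with <-cmp b t′
... | tri< b<t′ _ _ with <-cmp t′ d
...   | tri< t′<d _ _ = b<t′ , t′<d
...   | tri≈ _ refl _ = contradiction (Same.trans E bd (Same.sym E tt′)) ¬bt
...   | tri> _ _ d<t′ = contradiction (nc b t d t′ b<t t<d d<t′ bd tt′) ¬bt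
NonCrossing-nested {E = E} {b} {d} {t} {t′} nc bd tt′ ¬bt (b<t , t<d) | tri≈ _ refl _ =
  contradiction (Same.sym E tt′) ¬bt
NonCrossing-nested {E = E} {b} {d} {t} {t′} nc bd tt′ ¬bt (b<t , t<d) | tri> _ _ t′<b =
  contradiction (Same.trans E (Same.sym E (nc t′ b t d t′<b b<t t<d (Same.sym E tt′) bd)) (Same.sym E tt′))
    ¬bt

-- Merging points of a noncrossing partition

adjacent-inside : ∀ {p q s i o} → p ℕ.< i → i ℕ.< q →
  i ≡ s ⊎ i ≡ ℕ.suc s → o ≡ s ⊎ o ≡ ℕ.suc s → o ≢ p → o ≢ q → p ℕ.< o × o ℕ.< q
adjacent-inside p<i i<q (inj₁ refl) (inj₁ refl) _ _ = p<i , i<q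
adjacent-inside p<i i<q (inj₂ refl) (inj₂ refl) _ _ = p<i , i<q
adjacent-inside p<s s<q (inj₁ refl) (inj₂ refl) _ o≢q = ℕₚ.<-trans p<s (ℕₚ.n<1+n _) , ℕₚ.≤∧≢⇒< s<q o≢q
adjacent-inside p<o+1 o+1<q (inj₂ refl) (inj₁ refl) o≢p _ =
  ℕₚ.≤∧≢⇒< (ℕₚ.≤-pred p<o+1) (λ p≡o → o≢p (sym p≡o)) , ℕₚ.<-trans (ℕₚ.n<1+n _) o+1<q

module _ (E : Partition m) (s s′ : Fin m) where

  touches : Fin m → Bool
  touches z = rel E z s ∨ rel E z s′

  touching-endpoint : ∀ {z} → touches z ≡ true → Σ[ t ∈ Fin m ] Same E z t × (t ≡ s ⊎ t ≡ s′)
  touching-endpoint {z} tz with ∨-true {rel E z s} tz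
  ... | inj₁ zs  = s , zs , inj₁ refl
  ... | inj₂ zs′ = s′ , zs′ , inj₂ refl

  touches-endpoint : ∀ {z t} → Same E z t → t ≡ s ⊎ t ≡ s′ → touches z ≡ true
  touches-endpoint zs  (inj₁ refl) = ∨-trueˡ zs
  touches-endpoint {z} zs′ (inj₂ refl) = ∨-trueʳ {rel E z s} zs′

  touches-resp : ∀ {z w} → Same E z w → touches w ≡ true → touches z ≡ true
  touches-resp zw tw with touching-endpoint tw
  ... | t , wt , e = touches-endpoint (Same.trans E zw wt) e

  mergeRel : Fin m → Fin m → Bool
  mergeRel i j = rel E i j ∨ (touches i ∧ touches j)

  mergeRel-cases : ∀ {i j} → mergeRel i j ≡ true → Same E i j ⊎ (touches i ≡ true × touches j ≡ true)
  mergeRel-cases {i} {j} h with ∨-true {rel E i j} h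
  ... | inj₁ ij = inj₁ ij
  ... | inj₂ tt = inj₂ (∧-conicalˡ (touches i) _ tt , ∧-conicalʳ (touches i) _ tt)

  mergeRel-touching : ∀ {i j} → touches i ≡ true → touches j ≡ true → mergeRel i j ≡ true
  mergeRel-touching {i} ti tj = ∨-trueʳ {rel E i _} (∧-true ti tj)

  private
    mergeRel-sym : ∀ i j → mergeRel i j ≡ true → mergeRel j i ≡ true
    mergeRel-sym i j h with mergeRel-cases h
    ... | inj₁ ij = ∨-trueˡ (Same.sym E ij)
    ... | inj₂ (ti , tj) = mergeRel-touching tj ti

    mergeRel-trans : ∀ i j k → mergeRel i j ≡ true → mergeRel j k ≡ true → mergeRel i k ≡ true
    mergeRel-trans i j k hij hjk with mergeRel-cases hij | mergeRel-cases hjk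
    ... | inj₁ ij        | inj₁ jk        = ∨-trueˡ (Same.trans E ij jk)
    ... | inj₁ ij        | inj₂ (tj , tk) = mergeRel-touching (touches-resp ij tj) tk
    ... | inj₂ (ti , tj) | inj₁ jk        = mergeRel-touching ti (touches-resp (Same.sym E jk) tj)
    ... | inj₂ (ti , _)  | inj₂ (_ , tk)  = mergeRel-touching ti tk

  merge : Partition m
  merge = record
    { rel = mergeRel
    ; rrefl = λ i → ∨-trueˡ (Same.refl E)
    ; rsym = mergeRel-sym
    ; rtrans = mergeRel-trans
    }

  ≼-merge : E ≼ merge
  ≼-merge i j = ∨-trueˡ

  merge-joins : Same merge s s′
  merge-joins = mergeRel-touching (touches-endpoint (Same.refl E) (inj₁ refl))
                                  (touches-endpoint (Same.refl E) (inj₂ refl))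

  merge-least : ∀ {_∼_ : Rel (Fin m) 0ℓ} → IsEquivalence _∼_ → Same E ⇒ _∼_ → s ∼ s′ → Same merge ⇒ _∼_
  merge-least {_∼_} ∼-eq E⇒∼ s∼s′ h with mergeRel-cases h
  ... | inj₁ ij = E⇒∼ ij
  ... | inj₂ (ti , tj) = ∼.trans (∼-endpoint ti) (∼.sym (∼-endpoint tj))
    where
    module ∼ = IsEquivalence ∼-eq
    ∼-endpoint : ∀ {z} → touches z ≡ true → z ∼ s
    ∼-endpoint tz with touching-endpoint tz
    ... | _ , zs , inj₁ refl = E⇒∼ zs
    ... | _ , zs′ , inj₂ refl = ∼.trans (E⇒∼ zs′) (∼.sym s∼s′)

  module _ (nc : NonCrossing E) (adjacent : toℕ s′ ≡ ℕ.suc (toℕ s)) where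

    -- The two merged points are neighbours, so they lie on the same side of any block they avoid.
    untouched-block-encloses : ∀ {p q i o} → Same E p q → touches p ≡ false →
      p < i → i < q → touches i ≡ true → touches o ≡ true → p < o × o < q
    untouched-block-encloses {p} {q} {i} {o} pq tp p<i i<q ti to
      with touching-endpoint ti | touching-endpoint to
    ... | tᵢ , itᵢ , eᵢ | tₒ , otₒ , eₒ =
      NonCrossing-nested {E = E} nc pq (Same.sym E otₒ) (apart eₒ)
        (adjacent-inside (proj₁ inner) (proj₂ inner) (toℕ-endpoint eᵢ) (toℕ-endpoint eₒ)
          (λ tₒ≡p → apart eₒ (subst (Same E p) (toℕ-injective (sym tₒ≡p)) (Same.refl E)))
          (λ tₒ≡q → apart eₒ (subst (Same E p) (toℕ-injective (sym tₒ≡q)) pq)))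
      where
      apart : ∀ {t} → t ≡ s ⊎ t ≡ s′ → ¬ Same E p t
      apart e pt with trans (sym tp) (touches-endpoint pt e)
      ... | ()
      inner : p < tᵢ × tᵢ < q
      inner = NonCrossing-nested {E = E} nc pq itᵢ (λ pi → apart eᵢ (Same.trans E pi itᵢ)) (p<i , i<q)
      toℕ-endpoint : ∀ {t} → t ≡ s ⊎ t ≡ s′ → toℕ t ≡ toℕ s ⊎ toℕ t ≡ ℕ.suc (toℕ s)
      toℕ-endpoint (inj₁ refl) = inj₁ refl
      toℕ-endpoint (inj₂ refl) = inj₂ adjacent

    merge-nonCrossing : NonCrossing merge
    merge-nonCrossing a b c d a<b b<c c<d ac bd with mergeRel-cases ac | mergeRel-cases bd
    ... | inj₁ Eac | inj₁ Ebd = ∨-trueˡ (nc a b c d a<b b<c c<d Eac Ebd)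
    ... | inj₂ (ta , _) | inj₂ (tb , _) = mergeRel-touching ta tb
    ... | inj₂ (ta , tc) | inj₁ Ebd with touches b Bool.≟ true
    ...   | yes tb = mergeRel-touching ta tb
    ...   | no ¬tb = ⊥-elim (<-asym a<b (proj₁ (untouched-block-encloses Ebd (¬-not ¬tb) b<c c<d tc ta)))
    merge-nonCrossing a b c d a<b b<c c<d ac bd | inj₁ Eac | inj₂ (tb , td) with touches a Bool.≟ true
    ...   | yes ta = mergeRel-touching ta tb
    ...   | no ¬ta = ⊥-elim (<-asym c<d (proj₂ (untouched-block-encloses Eac (¬-not ¬ta) a<b b<c tb td)))

module _ {A : Set} (f g : A → Fin m) where

  mergeAll : Partition m → List A → Partition m
  mergeAll E []       = E
  mergeAll E (x ∷ xs) = merge (mergeAll E xs) (f x) (g x)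

  ≼-mergeAll : ∀ E xs → E ≼ mergeAll E xs
  ≼-mergeAll E []       i j = id
  ≼-mergeAll E (x ∷ xs) i j = ≼-merge (mergeAll E xs) (f x) (g x) i j ∘ ≼-mergeAll E xs i j

  mergeAll-joins : ∀ E {xs x} → x ∈ xs → Same (mergeAll E xs) (f x) (g x)
  mergeAll-joins E {x ∷ xs} (here refl) = merge-joins (mergeAll E xs) (f x) (g x)
  mergeAll-joins E {y ∷ xs} (there x∈xs) =
    ≼-merge (mergeAll E xs) (f y) (g y) _ _ (mergeAll-joins E x∈xs)

  mergeAll-least : ∀ {E} {_∼_ : Rel (Fin m) 0ℓ} → IsEquivalence _∼_ → Same E ⇒ _∼_ →
    (∀ x → f x ∼ g x) → ∀ xs → Same (mergeAll E xs) ⇒ _∼_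
  mergeAll-least ∼-eq E⇒∼ f∼g []       = E⇒∼
  mergeAll-least ∼-eq E⇒∼ f∼g (x ∷ xs) =
    merge-least (mergeAll _ xs) (f x) (g x) ∼-eq (mergeAll-least ∼-eq E⇒∼ f∼g xs) (f∼g x)

  mergeAll-nonCrossing : ∀ {E} → (∀ x → toℕ (g x) ≡ ℕ.suc (toℕ (f x))) →
    NonCrossing E → ∀ xs → NonCrossing (mergeAll E xs)
  mergeAll-nonCrossing adjacent nc []       = nc
  mergeAll-nonCrossing adjacent nc (x ∷ xs) =
    merge-nonCrossing (mergeAll _ xs) (f x) (g x) (mergeAll-nonCrossing adjacent nc xs) (adjacent x)

-- The interleaved product in coordinates

combine-mono-≤-< : ∀ {k} (x y : Fin n) {i j : Fin k} → x ≤ y → i < j → combine x i < combine y j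
combine-mono-≤-< {k = k} x y {i} {j} x≤y i<j =
  subst₂ ℕ._<_ (sym (toℕ-combine x i)) (sym (toℕ-combine y j)) (ℕₚ.+-mono-≤-< (ℕₚ.*-monoʳ-≤ k x≤y) i<j)

combine-cancel-≤ : ∀ {k} (x y : Fin n) {i j : Fin k} → combine x i < combine y j → x ≤ y
combine-cancel-≤ x y {i} {j} h = ℕₚ.≮⇒≥ (λ y<x → <-asym h (combine-monoˡ-< j i y<x))

combine-cancel-< : ∀ {k} (x y : Fin n) {i j : Fin k} → combine x i < combine y j → j ≤ i → x < y
combine-cancel-< {k = k} x y {i} {j} h j≤i with <-cmp x y
... | tri< x<y _ _ = x<y
... | tri≈ _ refl _ = contradiction j≤i (ℕₚ.<⇒≱ (ℕₚ.+-cancelˡ-< (k ℕ.* toℕ x) (toℕ i) (toℕ j)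
                        (subst₂ ℕ._<_ (toℕ-combine x i) (toℕ-combine x j) h)))
... | tri> _ _ y<x = ⊥-elim (<-asym h (combine-monoˡ-< j i y<x))

module _ {k} (P : Fin k → Partition n) where

  star-combine : ∀ x i y j → rel (star k P) (combine x i) (combine y j) ≡ starRel P (x , i) (y , j)
  star-combine x i y j = cong₂ (starRel P) (remQuot-combine x i) (remQuot-combine y j)

  star-same : ∀ {x y} i → Same (P i) x y → Same (star k P) (combine x i) (combine y i)
  star-same {x} {y} i h = trans (star-combine x i y i) (∧-true (eqF-refl i) h)

  star-same-colour : ∀ {x y i j} → Same (star k P) (combine x i) (combine y j) → i ≡ j
  star-same-colour {x} {y} {i} {j} h =
    eqF-sound i j (∧-conicalˡ (eqF i j) _ (trans (sym (star-combine x i y j)) h))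

  star-nonCrossing-intro :
    (∀ {a ca b cb c cc d cd} →
      combine a ca < combine b cb → combine b cb < combine c cc → combine c cc < combine d cd →
      starRel P (a , ca) (c , cc) ≡ true → starRel P (b , cb) (d , cd) ≡ true →
      starRel P (a , ca) (b , cb) ≡ true) →
    NonCrossing (star k P)
  star-nonCrossing-intro crossing a b c d a<b b<c c<d ac bd =
    crossing (subst₂ _<_ (sym (decode a)) (sym (decode b)) a<b)
             (subst₂ _<_ (sym (decode b)) (sym (decode c)) b<c)
             (subst₂ _<_ (sym (decode c)) (sym (decode d)) c<d) ac bd
    where
    decode : ∀ p → uncurry combine (remQuot {n} k p) ≡ p
    decode = combine-remQuot {n} k

-- Intervals that are unions of blocks

<ᵇ-view : (x t : Fin n) → Reflects (x < t) (toℕ x ℕ.<ᵇ toℕ t)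
<ᵇ-view x t = ℕₚ.<ᵇ-reflects-< (toℕ x) (toℕ t)

-- between x y is the indicator of the half-open interval (min x y , max x y].
between : Fin n → Fin n → Fin n → Bool
between x y t = (toℕ x ℕ.<ᵇ toℕ t) xor (toℕ y ℕ.<ᵇ toℕ t)

xor-cancel-middle : ∀ a b c → (a xor b) xor (b xor c) ≡ a xor c
xor-cancel-middle true  true  c = refl
xor-cancel-middle true  false c = refl
xor-cancel-middle false true  c = not-involutive c
xor-cancel-middle false false c = refl

between-self : (x t : Fin n) → between x x t ≡ false
between-self x t = xor-same (toℕ x ℕ.<ᵇ toℕ t)

between-sym : (x y t : Fin n) → between x y t ≡ between y x t
between-sym x y t = xor-comm (toℕ x ℕ.<ᵇ toℕ t) (toℕ y ℕ.<ᵇ toℕ t)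

between-trans : (x y z t : Fin n) → between x y t xor between y z t ≡ between x z t
between-trans x y z t = xor-cancel-middle (toℕ x ℕ.<ᵇ toℕ t) (toℕ y ℕ.<ᵇ toℕ t) (toℕ z ℕ.<ᵇ toℕ t)

between-inside : {x y t : Fin n} → x < t → t ≤ y → between x y t ≡ true
between-inside {x = x} {y} {t} x<t t≤y
  with toℕ x ℕ.<ᵇ toℕ t | <ᵇ-view x t | toℕ y ℕ.<ᵇ toℕ t | <ᵇ-view y t
... | true  | _         | false | _         = refl
... | false | ofⁿ x≮t   | _     | _         = contradiction x<t x≮t
... | true  | _         | true  | ofʸ y<t   = contradiction t≤y (ℕₚ.<⇒≱ y<t)

between-below : {x y t : Fin n} → t ≤ x → x ≤ y → between x y t ≡ false
between-below {x = x} {y} {t} t≤x x≤y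
  with toℕ x ℕ.<ᵇ toℕ t | <ᵇ-view x t | toℕ y ℕ.<ᵇ toℕ t | <ᵇ-view y t
... | false | _       | false | _       = refl
... | true  | ofʸ x<t | _     | _       = contradiction t≤x (ℕₚ.<⇒≱ x<t)
... | false | _       | true  | ofʸ y<t = contradiction (ℕₚ.≤-trans t≤x x≤y) (ℕₚ.<⇒≱ y<t)

between-above : {x y t : Fin n} → x ≤ y → y < t → between x y t ≡ false
between-above {x = x} {y} {t} x≤y y<t
  with toℕ x ℕ.<ᵇ toℕ t | <ᵇ-view x t | toℕ y ℕ.<ᵇ toℕ t | <ᵇ-view y t
... | true  | _       | true  | _       = refl
... | false | ofⁿ x≮t | _     | _       = contradiction (ℕₚ.≤-<-trans x≤y y<t) x≮t
... | true  | _       | false | ofⁿ y≮t = contradiction y<t y≮t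

between-inside⁻¹ : {x y t : Fin n} → x ≤ y → between x y t ≡ true → x < t × t ≤ y
between-inside⁻¹ {x = x} {y} {t} x≤y h
  with toℕ x ℕ.<ᵇ toℕ t | <ᵇ-view x t | toℕ y ℕ.<ᵇ toℕ t | <ᵇ-view y t
... | true  | ofʸ x<t | false | ofⁿ y≮t = x<t , ℕₚ.≮⇒≥ y≮t
... | false | ofⁿ x≮t | true  | ofʸ y<t = contradiction (ℕₚ.≤-<-trans x≤y y<t) x≮t

between-outside⁻¹ : {x y t : Fin n} → x ≤ y → between x y t ≡ false → t ≤ x ⊎ y < t
between-outside⁻¹ {x = x} {y} {t} x≤y h
  with toℕ x ℕ.<ᵇ toℕ t | <ᵇ-view x t | toℕ y ℕ.<ᵇ toℕ t | <ᵇ-view y t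
... | false | ofⁿ x≮t | false | _       = inj₁ (ℕₚ.≮⇒≥ x≮t)
... | true  | _       | true  | ofʸ y<t = inj₂ y<t

between-lower : {x y : Fin n} → x ≤ y → between x y x ≡ false
between-lower x≤y = between-below ≤-refl x≤y

between-upper : {x y : Fin n} → x < y → between x y y ≡ true
between-upper x<y = between-inside x<y ≤-refl

between-ends : {x y : Fin n} → x ≢ y → between x y y ≢ between x y x
between-ends {x = x} {y} x≢y e with <-cmp x y
... | tri< x<y _ _ = true≢false (begin
  true          ≡⟨ between-upper x<y ⟨
  between x y y ≡⟨ e ⟩
  between x y x ≡⟨ between-lower (ℕₚ.<⇒≤ x<y) ⟩
  false         ∎)
  where open ≡-Reasoning
... | tri≈ _ x≡y _ = x≢y x≡y
... | tri> _ _ y<x = true≢false (begin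
  true          ≡⟨ between-upper y<x ⟨
  between y x x ≡⟨ between-sym y x x ⟩
  between x y x ≡⟨ e ⟨
  between x y y ≡⟨ between-sym x y y ⟩
  between y x y ≡⟨ between-lower (ℕₚ.<⇒≤ y<x) ⟩
  false         ∎)
  where open ≡-Reasoning

Saturated : Partition n → (Fin n → Bool) → Set
Saturated π S = ∀ z w → Same π z w → S z ≡ S w

module _ {π : Partition n} where

  saturated-intro : ∀ {S} → (∀ z w → Same π z w → S z ≡ true → S w ≡ true) → Saturated π S
  saturated-intro closed z w zw = true-ext (closed z w zw) (closed w z (Same.sym π zw))

  saturated-resp : ∀ {S S′} → (∀ t → S t ≡ S′ t) → Saturated π S → Saturated π S′
  saturated-resp S≗S′ sat z w zw = trans (sym (S≗S′ z)) (trans (sat z w zw) (S≗S′ w))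

  saturated-map₂ : ∀ {S S′} (f : Bool → Bool → Bool) → Saturated π S → Saturated π S′ →
    Saturated π (λ t → f (S t) (S′ t))
  saturated-map₂ f sat sat′ z w zw = cong₂ f (sat z w zw) (sat′ z w zw)

Unsplit : Partition n → Fin n → Fin n → Set
Unsplit π x y = Saturated π (between x y)

Unsplit-isEquivalence : (π : Partition n) → IsEquivalence (Unsplit π)
Unsplit-isEquivalence π = record
  { refl = λ {x} z w _ → trans (between-self x z) (sym (between-self x w))
  ; sym = λ {x} {y} → saturated-resp {π = π} {S = between x y} (between-sym x y)
  ; trans = λ {x} {y} {z} sxy syz → saturated-resp {π = π} {S = λ t → between x y t xor between y z t}
      (between-trans x y z) (saturated-map₂ {π = π} {S = between x y} _xor_ sxy syz)
  }

module Unsplit {n} (π : Partition n) = IsEquivalence (Unsplit-isEquivalence π)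

xor-chain∧ : ∀ a b c d → (T b → T a) → (T c → T b) → (T d → T c) → (a xor c) ∧ not (b xor d) ≡ a xor b
xor-chain∧ true  true  true  true  _ _ _ = refl
xor-chain∧ true  true  true  false _ _ _ = refl
xor-chain∧ true  true  false false _ _ _ = refl
xor-chain∧ true  false false false _ _ _ = refl
xor-chain∧ false false false false _ _ _ = refl
xor-chain∧ false true  _     _     b⇒a _ _ = ⊥-elim (b⇒a _)
xor-chain∧ _     false true  _     _ c⇒b _ = ⊥-elim (c⇒b _)
xor-chain∧ _     _     false true  _ _ d⇒c = ⊥-elim (d⇒c _)

xor-chain∨ : ∀ a b c d → (T b → T a) → (T c → T b) → (T d → T c) → (a xor c) ∨ (d xor b) ≡ a xor d
xor-chain∨ true  true  true  true  _ _ _ = refl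
xor-chain∨ true  true  true  false _ _ _ = refl
xor-chain∨ true  true  false false _ _ _ = refl
xor-chain∨ true  false false false _ _ _ = refl
xor-chain∨ false false false false _ _ _ = refl
xor-chain∨ false true  _     _     b⇒a _ _ = ⊥-elim (b⇒a _)
xor-chain∨ _     false true  _     _ c⇒b _ = ⊥-elim (c⇒b _)
xor-chain∨ _     _     false true  _ _ d⇒c = ⊥-elim (d⇒c _)

module _ {u x v y : Fin n} (t : Fin n) where

  private
    lt : Fin n → Bool
    lt p = toℕ p ℕ.<ᵇ toℕ t

    lt-antitone : ∀ {p q} → p ≤ q → T (lt q) → T (lt p)
    lt-antitone {p} {q} p≤q h = ℕₚ.<⇒<ᵇ (ℕₚ.≤-<-trans p≤q (ℕₚ.<ᵇ⇒< (toℕ q) (toℕ t) h))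

  between-split∧ : u ≤ x → x < v → v ≤ y → between u v t ∧ not (between x y t) ≡ between u x t
  between-split∧ u≤x x<v v≤y = xor-chain∧ (lt u) (lt x) (lt v) (lt y)
    (lt-antitone u≤x) (lt-antitone (ℕₚ.<⇒≤ x<v)) (lt-antitone v≤y)

  between-split∨ : x < v → v ≤ y → y < u → between x y t ∨ between u v t ≡ between x u t
  between-split∨ x<v v≤y y<u = xor-chain∨ (lt x) (lt v) (lt y) (lt u)
    (lt-antitone (ℕₚ.<⇒≤ x<v)) (lt-antitone v≤y) (lt-antitone (ℕₚ.<⇒≤ y<u))

module _ {π : Partition n} where

  -- (u, x] = (u, v] ∖ (x, y] when u ≤ x, and (x, u] = (x, y] ∪ (v, u] when y < u.
  unsplit-at-entry : {x y u v : Fin n} → x < y → Unsplit π x y → Unsplit π u v →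
    between x y u ≡ false → between x y v ≡ true → Unsplit π x u
  unsplit-at-entry {x} {y} {u} {v} x<y sxy suv u∉ v∈
    with between-outside⁻¹ (ℕₚ.<⇒≤ x<y) u∉ | between-inside⁻¹ (ℕₚ.<⇒≤ x<y) v∈
  ... | inj₁ u≤x | x<v , v≤y = Unsplit.sym π
    (saturated-resp {π = π} {S = λ t → between u v t ∧ not (between x y t)}
      (λ t → between-split∧ t u≤x x<v v≤y)
      (saturated-map₂ {π = π} {S = between u v} {between x y} (λ a b → a ∧ not b) suv sxy))
  ... | inj₂ y<u | x<v , v≤y =
    saturated-resp {π = π} {S = λ t → between x y t ∨ between u v t} (λ t → between-split∨ t x<v v≤y y<u)
      (saturated-map₂ {π = π} {S = between x y} {between u v} _∨_ sxy suv)

  unsplit-across : {x y u v : Fin n} → x ≢ y → Unsplit π x y → Unsplit π u v →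
    between x y u ≡ between x y x → between x y v ≡ between x y y → Unsplit π x u × Unsplit π v y
  unsplit-across {x} {y} {u} {v} x≢y sxy suv ux vy with <-cmp x y
  ... | tri< x<y _ _ =
    sxu , Unsplit.trans π (Unsplit.trans π (Unsplit.sym π suv) (Unsplit.sym π sxu)) sxy
    where
    sxu : Unsplit π x u
    sxu = unsplit-at-entry x<y sxy suv
      (trans ux (between-lower (ℕₚ.<⇒≤ x<y))) (trans vy (between-upper x<y))
  ... | tri≈ _ x≡y _ = contradiction x≡y x≢y
  ... | tri> _ _ y<x = Unsplit.trans π sxy (Unsplit.trans π syv (Unsplit.sym π suv)) , Unsplit.sym π syv
    where
    open ≡-Reasoning
    syv : Unsplit π y v
    syv = unsplit-at-entry y<x (Unsplit.sym π sxy) (Unsplit.sym π suv)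
      (begin
        between y x v ≡⟨ between-sym y x v ⟩
        between x y v ≡⟨ vy ⟩
        between x y y ≡⟨ between-sym x y y ⟩
        between y x y ≡⟨ between-lower (ℕₚ.<⇒≤ y<x) ⟩
        false         ∎)
      (begin
        between y x u ≡⟨ between-sym y x u ⟩
        between x y u ≡⟨ ux ⟩
        between x y x ≡⟨ between-sym x y x ⟩
        between y x x ≡⟨ between-upper y<x ⟩
        true          ∎)

module _ {k} {P : Fin k → Partition n} (nc : NonCrossing (star k P)) {i j : Fin k} (i<j : i < j) where

  private
    star-unsplit-< : ∀ {x y} → x < y → Same (P j) x y → Unsplit (P i) x y
    star-unsplit-< {x} {y} x<y xy = saturated-intro {π = P i} {S = between x y} λ z w zw z∈ →
      let x<z , z≤y = between-inside⁻¹ (ℕₚ.<⇒≤ x<y) z∈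
          x<w , w<y = NonCrossing-nested {E = star k P} nc (star-same P j xy) (star-same P i zw)
                        (λ same → <⇒≢ i<j (sym (star-same-colour P same)))
                        (combine-monoˡ-< j i x<z , combine-mono-≤-< z y z≤y i<j)
      in between-inside (combine-cancel-< x w x<w (ℕₚ.<⇒≤ i<j)) (combine-cancel-≤ w y w<y)

  star-unsplit : ∀ {x y} → Same (P j) x y → Unsplit (P i) x y
  star-unsplit {x} {y} xy with <-cmp x y
  ... | tri< x<y _ _ = star-unsplit-< x<y xy
  ... | tri≈ _ refl _ = Unsplit.refl (P i)
  ... | tri> _ _ y<x = Unsplit.sym (P i) (star-unsplit-< y<x (Same.sym (P j) xy))

admissible-unsplit : {π δ : Partition n} → Admissible₂ π δ → ∀ {x y} → Same δ x y → Unsplit π x y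
admissible-unsplit {π = π} {δ} adm = star-unsplit {P = pair π δ} adm {zero} {suc zero} (ℕ.s≤s ℕ.z≤n)

unsplit⇒admissible : {π δ : Partition n} → NonCrossing π → NonCrossing δ →
  (∀ {x y} → Same δ x y → Unsplit π x y) → Admissible₂ π δ
unsplit⇒admissible {π = π} {δ} ncπ ncδ unsplit = star-nonCrossing-intro (pair π δ) crossing
  where
  crossing : ∀ {a ca b cb c cc d cd} →
    combine a ca < combine b cb → combine b cb < combine c cc → combine c cc < combine d cd →
    starRel (pair π δ) (a , ca) (c , cc) ≡ true → starRel (pair π δ) (b , cb) (d , cd) ≡ true →
    starRel (pair π δ) (a , ca) (b , cb) ≡ true
  crossing {a} {zero} {b} {zero} {c} {zero} {d} {zero} a<b b<c c<d ac bd =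
    ncπ _ _ _ _ (combine-cancel-< a b a<b ℕ.z≤n) (combine-cancel-< b c b<c ℕ.z≤n)
                (combine-cancel-< c d c<d ℕ.z≤n) ac bd
  crossing {a} {suc zero} {b} {suc zero} {c} {suc zero} {d} {suc zero} a<b b<c c<d ac bd =
    ncδ _ _ _ _ (combine-cancel-< a b a<b ℕₚ.≤-refl) (combine-cancel-< b c b<c ℕₚ.≤-refl)
                (combine-cancel-< c d c<d ℕₚ.≤-refl) ac bd
  crossing {a} {zero} {b} {suc zero} {c} {zero} {d} {suc zero} a<b b<c c<d ac bd =
    ⊥-elim (true≢false (begin
      true          ≡⟨ between-inside b<c′ c≤d ⟨
      between b d c ≡⟨ unsplit bd c a (Same.sym π ac) ⟩
      between b d a ≡⟨ between-below (combine-cancel-≤ a b a<b) (ℕₚ.<⇒≤ (ℕₚ.<-≤-trans b<c′ c≤d)) ⟩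
      false         ∎))
    where
    open ≡-Reasoning
    b<c′ : b < c
    b<c′ = combine-cancel-< b c b<c ℕ.z≤n
    c≤d : c ≤ d
    c≤d = combine-cancel-≤ c d c<d
  crossing {a} {suc zero} {b} {zero} {c} {suc zero} {d} {zero} a<b b<c c<d ac bd =
    ⊥-elim (true≢false (begin
      true          ≡⟨ between-inside a<b′ b≤c ⟨
      between a c b ≡⟨ unsplit ac b d bd ⟩
      between a c d ≡⟨ between-above (ℕₚ.<⇒≤ (ℕₚ.<-≤-trans a<b′ b≤c)) (combine-cancel-< c d c<d ℕ.z≤n) ⟩
      false         ∎))
    where
    open ≡-Reasoning
    a<b′ : a < b
    a<b′ = combine-cancel-< a b a<b ℕ.z≤n
    b≤c : b ≤ c
    b≤c = combine-cancel-≤ b c b<c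
  crossing {ca = zero}     {cc = suc zero} _ _ _ () _
  crossing {ca = suc zero} {cc = zero}     _ _ _ () _
  crossing {cb = zero}     {cd = suc zero} _ _ _ _ ()
  crossing {cb = suc zero} {cd = zero}     _ _ _ _ ()

-- The composite as a join

c₀ c₁ : Fin n → Fin (n ℕ.* 2)
c₀ x = combine x zero
c₁ x = combine x (suc zero)

quotient-combine : ∀ {k} (x : Fin n) (i : Fin k) → quotient {n} k (combine x i) ≡ x
quotient-combine x i = cong proj₁ (remQuot-combine x i)

c₁-adjacent : (x : Fin n) → toℕ (c₁ x) ≡ ℕ.suc (toℕ (c₀ x))
c₁-adjacent x = begin
  toℕ (c₁ x)              ≡⟨ toℕ-combine x (suc zero) ⟩
  2 ℕ.* toℕ x ℕ.+ 1       ≡⟨ ℕₚ.+-comm _ 1 ⟩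
  ℕ.suc (2 ℕ.* toℕ x)     ≡⟨ cong ℕ.suc (ℕₚ.+-identityʳ _) ⟨
  ℕ.suc (2 ℕ.* toℕ x ℕ.+ 0) ≡⟨ cong ℕ.suc (toℕ-combine x zero) ⟨
  ℕ.suc (toℕ (c₀ x))      ∎
  where open ≡-Reasoning

sqrtP-nonCrossing : ∀ {n} {γ : Partition (n ℕ.* 2)} → NonCrossing γ → NonCrossing (sqrtP {n} γ)
sqrtP-nonCrossing nc a b c d a<b b<c c<d =
  nc (c₁ a) (c₁ b) (c₁ c) (c₁ d) (c₁-mono a<b) (c₁-mono b<c) (c₁-mono c<d)
  where
  c₁-mono : ∀ {x y} → x < y → c₁ x < c₁ y
  c₁-mono = combine-monoˡ-< (suc zero) (suc zero)

module _ (α β : Partition n) where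

  starJoin : Partition (n ℕ.* 2)
  starJoin = mergeAll c₀ c₁ (star 2 (pair α β)) (allFin n)

  ≼-starJoin : star 2 (pair α β) ≼ starJoin
  ≼-starJoin = ≼-mergeAll c₀ c₁ _ (allFin n)

  starJoin-c₀c₁ : (x : Fin n) → Same starJoin (c₀ x) (c₁ x)
  starJoin-c₀c₁ x = mergeAll-joins c₀ c₁ _ (∈-allFin x)

  pairing-≼-starJoin : pairing n ≼ starJoin
  pairing-≼-starJoin p q h = Same.trans starJoin (to-c₀ p)
    (subst (λ x → Same starJoin (c₀ x) q) (sym (eqF-sound (quotient {n} 2 p) (quotient {n} 2 q) h))
      (Same.sym starJoin (to-c₀ q)))
    where
    combine-to-c₀ : (x : Fin n) (i : Fin 2) → Same starJoin (combine x i) (c₀ x)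
    combine-to-c₀ x zero       = Same.refl starJoin
    combine-to-c₀ x (suc zero) = Same.sym starJoin (starJoin-c₀c₁ x)
    to-c₀ : ∀ p → Same starJoin p (c₀ (quotient {n} 2 p))
    to-c₀ p = subst (λ p → Same starJoin p (c₀ (quotient {n} 2 p))) (combine-remQuot {n} 2 p)
      (subst (λ y → Same starJoin (combine x i) (c₀ y)) (sym (quotient-combine x i)) (combine-to-c₀ x i))
      where
      x : Fin n
      x = proj₁ (remQuot {n} 2 p)
      i : Fin 2
      i = proj₂ (remQuot {n} 2 p)

  starJoin-isJoin : Admissible₂ α β → IsJoinNC (star 2 (pair α β)) (pairing n) starJoin
  starJoin-isJoin adm =
    mergeAll-nonCrossing c₀ c₁ c₁-adjacent adm (allFin n) , ≼-starJoin , pairing-≼-starJoin ,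
    λ τ _ star≼τ pairing≼τ → λ p q → mergeAll-least c₀ c₁ (Same-isEquivalence τ) (star≼τ _ _)
      (λ x → pairing≼τ (c₀ x) (c₁ x) (subst₂ (λ y z → eqF y z ≡ true)
        (sym (quotient-combine x zero)) (sym (quotient-combine x (suc zero))) (eqF-refl x))) (allFin n)

infixl 30 _⊔_

_⊔_ : Partition n → Partition n → Partition n
α ⊔ β = sqrtP (starJoin α β)

module _ {α β : Partition n} where

  ⊔-nonCrossing : Admissible₂ α β → NonCrossing (α ⊔ β)
  ⊔-nonCrossing adm = sqrtP-nonCrossing {γ = starJoin α β} (proj₁ (starJoin-isJoin α β adm))

  ⊔-least : ∀ {_∼_ : Rel (Fin n) 0ℓ} → IsEquivalence _∼_ →
    Same α ⇒ _∼_ → Same β ⇒ _∼_ → Same (α ⊔ β) ⇒ _∼_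
  ⊔-least {_∼_} ∼-eq α⇒∼ β⇒∼ {x} {y} h =
    subst₂ _∼_ (quotient-combine x (suc zero)) (quotient-combine y (suc zero))
    (mergeAll-least c₀ c₁ (On.isEquivalence (quotient {n} 2) ∼-eq) star⇒∼ c₀∼c₁ (allFin n) h)
    where
    star⇒∼ : Same (star 2 (pair α β)) ⇒ (_∼_ on quotient {n} 2)
    star⇒∼ {p} {q} = colour-step (remQuot {n} 2 p) (remQuot {n} 2 q)
      where
      colour-step : ∀ u v → starRel (pair α β) u v ≡ true → proj₁ u ∼ proj₁ v
      colour-step (x , zero)     (y , zero)     h = α⇒∼ h
      colour-step (x , suc zero) (y , suc zero) h = β⇒∼ h
    c₀∼c₁ : ∀ x → quotient {n} 2 (c₀ x) ∼ quotient {n} 2 (c₁ x)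
    c₀∼c₁ x = subst₂ _∼_ (sym (quotient-combine x zero)) (sym (quotient-combine x (suc zero)))
                         (IsEquivalence.refl ∼-eq)

≼-⊔ˡ : (α β : Partition n) → α ≼ α ⊔ β
≼-⊔ˡ {n} α β x y h = Same.trans J (Same.sym J (starJoin-c₀c₁ α β x))
  (Same.trans J (≼-starJoin α β (c₀ x) (c₀ y) (star-same (pair α β) zero h)) (starJoin-c₀c₁ α β y))
  where
  J : Partition (n ℕ.* 2)
  J = starJoin α β

≼-⊔ʳ : (α β : Partition n) → β ≼ α ⊔ β
≼-⊔ʳ α β x y h = ≼-starJoin α β (c₁ x) (c₁ y) (star-same (pair α β) (suc zero) h)

-- Cancellation

module _ {A : Set} {T : Rel A 0ℓ} where

  length : ∀ {x y} → Star T x y → ℕ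
  length ε       = 0
  length (_ ◅ p) = ℕ.suc (length p)

  record FirstExit (S : A → Bool) {x y} (p : Star T x y) : Set where
    field
      {u v}          : A
      before         : Star T x u
      step           : T u v
      after          : Star T v y
      stays          : S u ≡ S x
      arrives        : S v ≡ S y
      before-shorter : length before ℕ.< length p
      after-shorter  : length after ℕ.< length p

  firstExit : ∀ S {x y} (p : Star T x y) → S y ≢ S x → FirstExit S p
  firstExit S ε Sx≢Sx = contradiction refl Sx≢Sx
  firstExit S {x} (_◅_ {j = x₁} t p) Sy≢Sx with S x₁ Bool.≟ S x
  ... | no Sx₁≢Sx = record
    { before = ε ; step = t ; after = p
    ; stays = refl ; arrives = trans (¬-not Sx₁≢Sx) (sym (¬-not Sy≢Sx))
    ; before-shorter = ℕ.s≤s ℕ.z≤n ; after-shorter = ℕₚ.n<1+n _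
    }
  ... | yes Sx₁≡Sx = record
    { before = t ◅ before ; step = step ; after = after
    ; stays = trans stays Sx₁≡Sx ; arrives = arrives
    ; before-shorter = ℕ.s≤s before-shorter ; after-shorter = ℕₚ.m<n⇒m<1+n after-shorter
    }
    where open FirstExit (firstExit S p (λ Sy≡Sx₁ → Sy≢Sx (trans Sy≡Sx₁ Sx₁≡Sx)))

module _ {π δ : Partition n} where

  path-isEquivalence : IsEquivalence (Star (Same π ∪ Same δ))
  path-isEquivalence = record
    { refl = ε
    ; sym = reverse (Union.symmetric {L = Same π} {R = Same δ} (Same.sym π) (Same.sym δ))
    ; trans = _◅◅_
    }

  admissible-cancel : Admissible₂ π δ → ∀ {x y} → Same (π ⊔ δ) x y → Unsplit π x y → Same δ x y
  admissible-cancel adm xy =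
    cancel (⊔-least path-isEquivalence (return ∘ inj₁) (return ∘ inj₂) xy) (<-wellFounded _)
    where
    cancel : ∀ {x y} (p : Star (Same π ∪ Same δ) x y) → Acc ℕ._<_ (length p) → Unsplit π x y → Same δ x y
    cancel {x} {y} p (acc shorter) sxy with x ≟ y
    ... | yes refl = Same.refl δ
    ... | no x≢y = cross (firstExit (between x y) p (between-ends x≢y))
      where
      cross : FirstExit (between x y) p → Same δ x y
      cross record { u = u ; v = v ; step = inj₁ πuv ; stays = stays ; arrives = arrives } =
        ⊥-elim (between-ends x≢y (begin
          between x y y ≡⟨ arrives ⟨
          between x y v ≡⟨ sxy v u (Same.sym π πuv) ⟩
          between x y u ≡⟨ stays ⟩
          between x y x ∎))
        where open ≡-Reasoning
      cross record { before = before ; step = inj₂ δuv ; after = after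
                   ; stays = stays ; arrives = arrives
                   ; before-shorter = before< ; after-shorter = after< }
        with unsplit-across {π = π} x≢y sxy (admissible-unsplit adm δuv) stays arrives
      ... | sxu , svy = Same.trans δ (cancel before (shorter before<) sxu)
                          (Same.trans δ δuv (cancel after (shorter after<) svy))

-- Composition and relative Kreweras complements

Partition-setoid : ℕ → Setoid 0ℓ 0ℓ
Partition-setoid m = record { Carrier = Partition m ; _≈_ = _≈_ ; isEquivalence = ≈-isEquivalence }

IsJoinNC-unique : {π σ ρ ρ′ : Partition m} → IsJoinNC π σ ρ → IsJoinNC π σ ρ′ → ρ ≈ ρ′
IsJoinNC-unique {ρ = ρ} {ρ′} (ncρ , π≼ρ , σ≼ρ , ρ-least) (ncρ′ , π≼ρ′ , σ≼ρ′ , ρ′-least) =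
  ≼-antisym {π = ρ} {ρ′} (ρ-least ρ′ ncρ′ π≼ρ′ σ≼ρ′) (ρ′-least ρ ncρ π≼ρ σ≼ρ)

saturated-⊔ : {α β : Partition n} {S : Fin n → Bool} →
  Saturated α S → Saturated β S → Saturated (α ⊔ β) S
saturated-⊔ {S = S} satα satβ z w = ⊔-least (On.isEquivalence S ≡.isEquivalence) (satα _ _) (satβ _ _)

⊔-lub : (α β θ : Partition n) → α ≼ θ → β ≼ θ → α ⊔ β ≼ θ
⊔-lub α β θ α≼θ β≼θ x y h = ⊔-least (Same-isEquivalence θ) (λ {i} {j} → α≼θ i j) (λ {i} {j} → β≼θ i j) h

⊔-cong : {α α′ β β′ : Partition n} → α ≈ α′ → β ≈ β′ → α ⊔ β ≈ α′ ⊔ β′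
⊔-cong {α = α} {α′} {β} {β′} α≈α′ β≈β′ = ≼-antisym {π = α ⊔ β} {α′ ⊔ β′}
  (⊔-lub α β (α′ ⊔ β′) (λ i j → ≼-⊔ˡ α′ β′ i j ∘ ≈⇒≼ {π = α} {α′} α≈α′ i j)
                       (λ i j → ≼-⊔ʳ α′ β′ i j ∘ ≈⇒≼ {π = β} {β′} β≈β′ i j))
  (⊔-lub α′ β′ (α ⊔ β) (λ i j → ≼-⊔ˡ α β i j ∘ ≈⇒≼ {π = α′} {α} (≈.sym {x = α} {α′} α≈α′) i j)
                       (λ i j → ≼-⊔ʳ α β i j ∘ ≈⇒≼ {π = β′} {β} (≈.sym {x = β} {β′} β≈β′) i j))

⊔-assoc : (α β γ : Partition n) → α ⊔ β ⊔ γ ≈ α ⊔ (β ⊔ γ)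
⊔-assoc α β γ = ≼-antisym {π = α ⊔ β ⊔ γ} {α ⊔ (β ⊔ γ)}
  (⊔-lub (α ⊔ β) γ (α ⊔ (β ⊔ γ))
    (⊔-lub α β (α ⊔ (β ⊔ γ)) (≼-⊔ˡ α (β ⊔ γ)) (λ i j → ≼-⊔ʳ α (β ⊔ γ) i j ∘ ≼-⊔ˡ β γ i j))
    (λ i j → ≼-⊔ʳ α (β ⊔ γ) i j ∘ ≼-⊔ʳ β γ i j))
  (⊔-lub α (β ⊔ γ) (α ⊔ β ⊔ γ)
    (λ i j → ≼-⊔ˡ (α ⊔ β) γ i j ∘ ≼-⊔ˡ α β i j)
    (⊔-lub β γ (α ⊔ β ⊔ γ) (λ i j → ≼-⊔ˡ (α ⊔ β) γ i j ∘ ≼-⊔ʳ α β i j) (≼-⊔ʳ (α ⊔ β) γ)))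

Admissible₂-resp-≈ : {α α′ β β′ : Partition n} → α ≈ α′ → β ≈ β′ → Admissible₂ α β → Admissible₂ α′ β′
Admissible₂-resp-≈ {n = n} {α} {α′} {β} {β′} α≈α′ β≈β′ =
  NonCrossing-resp-≈ {π = star 2 (pair α β)} {star 2 (pair α′ β′)}
    (λ p q → by-colour (remQuot {n} 2 p) (remQuot {n} 2 q))
  where
  by-colour : ∀ u v → starRel (pair α β) u v ≡ starRel (pair α′ β′) u v
  by-colour (x , zero)     (y , j) = cong (eqF zero j ∧_) (α≈α′ x y)
  by-colour (x , suc zero) (y , j) = cong (eqF (suc zero) j ∧_) (β≈β′ x y)

module _ {n} {α β χ : Partition n} where

  comp-intro : Admissible₂ α β → α ⊔ β ≈ χ → Comp α β χ
  comp-intro adm ⊔≈χ = adm , starJoin α β , starJoin-isJoin α β adm , ⊔≈χ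

  comp-⊔ : Comp α β χ → α ⊔ β ≈ χ
  comp-⊔ (adm , j , j-isJoin , √j≈χ) x y =
    trans (IsJoinNC-unique {π = star 2 (pair α β)} {pairing n} {starJoin α β} {j}
             (starJoin-isJoin α β adm) j-isJoin (c₁ x) (c₁ y))
          (√j≈χ x y)

Comp-resp-≈ : {α α′ β β′ χ χ′ : Partition n} → α ≈ α′ → β ≈ β′ → χ ≈ χ′ → Comp α β χ → Comp α′ β′ χ′
Comp-resp-≈ {n = n} {α} {α′} {β} {β′} {χ} {χ′} α≈α′ β≈β′ χ≈χ′ c =
  comp-intro {α = α′} {β′} {χ′} (Admissible₂-resp-≈ α≈α′ β≈β′ (proj₁ c)) (begin
    α′ ⊔ β′ ≈⟨ ⊔-cong α≈α′ β≈β′ ⟨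
    α ⊔ β   ≈⟨ comp-⊔ {α = α} {β} {χ} c ⟩
    χ       ≈⟨ χ≈χ′ ⟩
    χ′      ∎)
  where open SetoidReasoning (Partition-setoid n)

Comp-cancelˡ : {π δ δ′ χ : Partition n} → Comp π δ χ → Comp π δ′ χ → δ ≈ δ′
Comp-cancelˡ {n = n} {π} {δ} {δ′} {χ} c c′ = ≼-antisym {π = δ} {δ′} (into c c′) (into c′ c)
  where
  into : ∀ {δ δ′} → Comp π δ χ → Comp π δ′ χ → δ ≼ δ′
  into {δ} {δ′} c c′ x y xy = admissible-cancel {π = π} {δ′} (proj₁ c′)
    (≈⇒≼ {π = π ⊔ δ} {π ⊔ δ′} ⊔≈⊔ x y (≼-⊔ʳ π δ x y xy)) (admissible-unsplit (proj₁ c) xy)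
    where
    ⊔≈⊔ : π ⊔ δ ≈ π ⊔ δ′
    ⊔≈⊔ = begin π ⊔ δ ≈⟨ comp-⊔ {α = π} {δ} {χ} c ⟩ χ ≈⟨ comp-⊔ {α = π} {δ′} {χ} c′ ⟨ π ⊔ δ′ ∎
      where open SetoidReasoning (Partition-setoid n)

comp-assoc : {α β γ ab abc : Partition n} →
  Comp α β ab → Comp ab γ abc → Admissible₂ α (β ⊔ γ) → Comp α (β ⊔ γ) abc
comp-assoc {n = n} {α} {β} {γ} {ab} {abc} αβ↦ab abγ↦abc adm = comp-intro {α = α} {β ⊔ γ} {abc} adm (begin
  α ⊔ (β ⊔ γ) ≈⟨ ⊔-assoc α β γ ⟨
  α ⊔ β ⊔ γ   ≈⟨ ⊔-cong (comp-⊔ {α = α} {β} {ab} αβ↦ab) (≈.refl {x = γ}) ⟩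
  ab ⊔ γ      ≈⟨ comp-⊔ {α = ab} {γ} {abc} abγ↦abc ⟩
  abc         ∎)
  where open SetoidReasoning (Partition-setoid n)

IsKrew-unique : {χ π γ δ : Partition n} → IsKrew χ π γ → IsKrew χ π δ → γ ≈ δ
IsKrew-unique {χ = χ} {π} {γ} {δ} (_ , πγ↦χ) (_ , πδ↦χ) = Comp-cancelˡ {π = π} {γ} {δ} {χ} πγ↦χ πδ↦χ

IsKrew-resp-≈ : {χ χ′ π π′ δ δ′ : Partition n} →
  χ ≈ χ′ → π ≈ π′ → δ ≈ δ′ → IsKrew χ π δ → IsKrew χ′ π′ δ′
IsKrew-resp-≈ {χ = χ} {χ′} {π} {π′} {δ} {δ′} χ≈χ′ π≈π′ δ≈δ′ (ncδ , c) =
  NonCrossing-resp-≈ {π = δ} {δ′} δ≈δ′ ncδ ,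
  Comp-resp-≈ {α = π} {π′} {δ} {δ′} {χ} {χ′} π≈π′ δ≈δ′ χ≈χ′ c

IsKrew⇔ : {χ π γ : Partition n} → IsKrew χ π γ → ∀ δ → IsKrew χ π δ ⇔ δ ≈ γ
IsKrew⇔ {χ = χ} {π} {γ} k δ = mk⇔
  (λ k′ → ≈.sym {x = γ} {δ} (IsKrew-unique {χ = χ} {π} {γ} {δ} k k′))
  (λ δ≈γ → IsKrew-resp-≈ {χ = χ} {χ} {π} {π} {γ} {δ}
             (≈.refl {x = χ}) (≈.refl {x = π}) (≈.sym {x = δ} {γ} δ≈γ) k)

⊔-comp : (α β : Partition n) → Admissible₂ α β → Comp α β (α ⊔ β)
⊔-comp α β adm = comp-intro {α = α} {β} {α ⊔ β} adm (≈.refl {x = α ⊔ β})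

module _ {α β γ : Partition n} (ncα : NonCrossing α) (ncβ : NonCrossing β) (ncγ : NonCrossing γ)
         (adm : Admissible₃ α β γ) where

  private
    β-unsplit-α : ∀ {x y} → Same β x y → Unsplit α x y
    β-unsplit-α = star-unsplit {P = triple α β γ} adm {zero} {suc zero} (ℕ.s≤s ℕ.z≤n)

    γ-unsplit-α : ∀ {x y} → Same γ x y → Unsplit α x y
    γ-unsplit-α = star-unsplit {P = triple α β γ} adm {zero} {suc (suc zero)} (ℕ.s≤s ℕ.z≤n)

    γ-unsplit-β : ∀ {x y} → Same γ x y → Unsplit β x y
    γ-unsplit-β = star-unsplit {P = triple α β γ} adm {suc zero} {suc (suc zero)} (ℕ.s≤s (ℕ.s≤s ℕ.z≤n))

  admissible₃⇒₁₂ : Admissible₂ α β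
  admissible₃⇒₁₂ = unsplit⇒admissible ncα ncβ β-unsplit-α

  admissible₃⇒₂₃ : Admissible₂ β γ
  admissible₃⇒₂₃ = unsplit⇒admissible ncβ ncγ γ-unsplit-β

  admissible₃⇒₁₂,₃ : Admissible₂ (α ⊔ β) γ
  admissible₃⇒₁₂,₃ = unsplit⇒admissible (⊔-nonCrossing admissible₃⇒₁₂) ncγ
    (λ g → saturated-⊔ (γ-unsplit-α g) (γ-unsplit-β g))

  admissible₃⇒₁,₂₃ : Admissible₂ α (β ⊔ γ)
  admissible₃⇒₁,₂₃ = unsplit⇒admissible ncα (⊔-nonCrossing admissible₃⇒₂₃)
    (⊔-least (Unsplit-isEquivalence α) β-unsplit-α γ-unsplit-α)

proposition3p25 : (n : ℕ) (α β γ : Partition n) →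
    NonCrossing α → NonCrossing β → NonCrossing γ → Admissible₃ α β γ →
    (Σ[ ab ∈ Partition n ] Σ[ abc ∈ Partition n ] (Comp α β ab × Comp ab γ abc)) ×
    ((ab abc : Partition n) → Comp α β ab → Comp ab γ abc →
      ((δ : Partition n) → IsKrew abc ab δ ⇔ δ ≈ γ) ×
      (Σ[ κ₁ ∈ Partition n ] IsKrew abc α κ₁) ×
      (Σ[ κ₂ ∈ Partition n ] IsKrew ab α κ₂) ×
      ((κ₁ κ₂ : Partition n) → IsKrew abc α κ₁ → IsKrew ab α κ₂ →
        (δ : Partition n) → IsKrew κ₁ κ₂ δ ⇔ δ ≈ γ))
proposition3p25 n α β γ ncα ncβ ncγ adm₃ =
  (α ⊔ β , α ⊔ β ⊔ γ , ⊔-comp α β adm₁₂ , ⊔-comp (α ⊔ β) γ (admissible₃⇒₁₂,₃ ncα ncβ ncγ adm₃)) ,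
  λ ab abc αβ↦ab abγ↦abc →
    let K-α : IsKrew abc α (β ⊔ γ)
        K-α = ⊔-nonCrossing adm₂₃ ,
              comp-assoc {α = α} {β} {γ} {ab} {abc} αβ↦ab abγ↦abc (admissible₃⇒₁,₂₃ ncα ncβ ncγ adm₃)
        K′-α : IsKrew ab α β
        K′-α = ncβ , αβ↦ab
    in IsKrew⇔ {χ = abc} {ab} {γ} (ncγ , abγ↦abc) , (β ⊔ γ , K-α) , (β , K′-α) ,
       λ κ₁ κ₂ k₁ k₂ → IsKrew⇔ {χ = κ₁} {κ₂} {γ}
         (IsKrew-resp-≈ {χ = β ⊔ γ} {κ₁} {β} {κ₂} {γ} {γ}
           (IsKrew-unique {χ = abc} {α} {β ⊔ γ} {κ₁} K-α k₁)
           (IsKrew-unique {χ = ab} {α} {β} {κ₂} K′-α k₂)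
           (≈.refl {x = γ}) (ncγ , ⊔-comp β γ adm₂₃))
  where
  adm₁₂ : Admissible₂ α β
  adm₁₂ = admissible₃⇒₁₂ ncα ncβ ncγ adm₃
  adm₂₃ : Admissible₂ β γ
  adm₂₃ = admissible₃⇒₂₃ ncα ncβ ncγ adm₃
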